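{- For every positive integer $x$ and every nonnegative integer $n$, \[ sf^{(n)}(x)=\prod_{k=1}^{x}\bigl[(x-k)+1\bigr]^{P_n(k)}=\prod_{k=1}^{x}k^{P_n((x-k)+1)}. \]
   Context: For integers $r\ge 0$ and $m\ge 1$, the $r$-simplex (figurate) number is $P_r(m)=\binom{m+r-1}{r}$ (so $P_0(m)=1$). The generalized ($n$th-degree) superfactorial is defined recursively for positive integers $x$ by $sf^{(0)}(x)=x!$ and, for $n\ge 1$, $sf^{(n)}(x)=\prod_{k=1}^{x} sf^{(n-1)}(k)$. (Thus $sf^{(1)}(x)=\prod_{k=1}^x k!$ is the usual superfactorial.) -}

module Defs where

open import Data.Nat using (ℕ; zero; suc; _+_; _*_; _∸_; _^_; _!)
open import Data.Nat.Combinatorics using (_C_)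

prod1 : ℕ → (ℕ → ℕ) → ℕ
prod1 zero    f = 1
prod1 (suc x) f = prod1 x f * f (suc x)

P : ℕ → ℕ → ℕ
P r m = (m + r ∸ 1) C r

sf : ℕ → ℕ → ℕ
sf zero    x = x !
sf (suc n) x = prod1 x (λ k → sf n k)

{-# OPTIONS --safe #-}
-- Pascal's rule for simplex numbers, P_{n+1}(m+1) = P_{n+1}(m) + P_n(m+1), is exactly the
-- exponent bookkeeping of sf^(n+1)(x+1) = sf^(n+1)(x) · sf^(n)(x+1); so by induction on n and x,
-- sf^(n)(x) = ∏ k^{P_n(x-k+1)}, starting from x! = ∏ k = ∏ k^{P_0(·)}.  The other product is
-- the same one read backwards, k ↦ x+1-k.
module Submission where

open import Defs
open import Data.Nat using (ℕ; zero; suc; _+_; _*_; _∸_; _^_; _!; _≤_)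
open import Data.Nat.Properties
open import Data.Nat.Combinatorics using (_C_; k>n⇒nCk≡0; nCk+nC[k+1]≡[n+1]C[k+1])
open import Data.Product using (_×_; _,_)
open import Relation.Binary.PropositionalEquality
  using (_≡_; refl; sym; trans; cong; cong₂; module ≡-Reasoning)
open ≡-Reasoning

∸+1≡suc∸ : ∀ {x k} → k ≤ x → (x ∸ k) + 1 ≡ suc x ∸ k
∸+1≡suc∸ {x} {k} k≤x = trans (+-comm (x ∸ k) 1) (sym (+-∸-assoc 1 k≤x))

prod1-cong : ∀ x {f g : ℕ → ℕ} → (∀ {k} → k ≤ x → f k ≡ g k) → prod1 x f ≡ prod1 x g
prod1-cong zero    f≗g = refl
prod1-cong (suc x) f≗g = cong₂ _*_ (prod1-cong x (λ k≤x → f≗g (m≤n⇒m≤1+n k≤x))) (f≗g ≤-refl)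

prod1-* : ∀ x (f g : ℕ → ℕ) → prod1 x (λ k → f k * g k) ≡ prod1 x f * prod1 x g
prod1-* zero    f g = refl
prod1-* (suc x) f g = begin
  prod1 x (λ k → f k * g k) * (f (suc x) * g (suc x))
    ≡⟨ cong (_* (f (suc x) * g (suc x))) (prod1-* x f g) ⟩
  (prod1 x f * prod1 x g) * (f (suc x) * g (suc x))
    ≡⟨ [m*n]*[o*p]≡[m*o]*[n*p] (prod1 x f) (prod1 x g) (f (suc x)) (g (suc x)) ⟩
  (prod1 x f * f (suc x)) * (prod1 x g * g (suc x)) ∎

prod1-extend : ∀ x {f : ℕ → ℕ} → f (suc x) ≡ 1 → prod1 (suc x) f ≡ prod1 x f
prod1-extend x {f} f[1+x]≡1 = trans (cong (prod1 x f *_) f[1+x]≡1) (*-identityʳ (prod1 x f))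

prod1-suc-first : ∀ x (f : ℕ → ℕ) → prod1 (suc x) f ≡ f 1 * prod1 x (λ k → f (suc k))
prod1-suc-first zero    f = *-comm 1 (f 1)
prod1-suc-first (suc x) f = begin
  prod1 (suc x) f * f (suc (suc x))
    ≡⟨ cong (_* f (suc (suc x))) (prod1-suc-first x f) ⟩
  (f 1 * prod1 x (λ k → f (suc k))) * f (suc (suc x))
    ≡⟨ *-assoc (f 1) _ _ ⟩
  f 1 * (prod1 x (λ k → f (suc k)) * f (suc (suc x))) ∎

prod1-reverse : ∀ x (f : ℕ → ℕ) → prod1 x f ≡ prod1 x (λ k → f (suc x ∸ k))
prod1-reverse zero    f = refl
prod1-reverse (suc x) f = begin
  prod1 x f * f (suc x)                      ≡⟨ *-comm (prod1 x f) _ ⟩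
  f (suc x) * prod1 x f                      ≡⟨ cong (f (suc x) *_) (prod1-reverse x f) ⟩
  f (suc x) * prod1 x (λ k → f (suc x ∸ k))  ≡⟨ prod1-suc-first x (λ k → f (suc (suc x) ∸ k)) ⟨
  prod1 (suc x) (λ k → f (suc (suc x) ∸ k))  ∎

prod1-reflect : ∀ x (f : ℕ → ℕ → ℕ) →
  prod1 x (λ k → f ((x ∸ k) + 1) k) ≡ prod1 x (λ k → f k ((x ∸ k) + 1))
prod1-reflect x f = begin
  prod1 x (λ k → f ((x ∸ k) + 1) k)
    ≡⟨ prod1-cong x (λ {k} k≤x → cong (λ j → f j k) (∸+1≡suc∸ k≤x)) ⟩
  prod1 x (λ k → f (suc x ∸ k) k)
    ≡⟨ prod1-reverse x _ ⟩
  prod1 x (λ k → f (suc x ∸ (suc x ∸ k)) (suc x ∸ k))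
    ≡⟨ prod1-cong x (λ {k} k≤x → cong (λ j → f j (suc x ∸ k)) (m∸[m∸n]≡n (m≤n⇒m≤1+n k≤x))) ⟩
  prod1 x (λ k → f k (suc x ∸ k))
    ≡⟨ prod1-cong x (λ {k} k≤x → cong (f k) (∸+1≡suc∸ k≤x)) ⟨
  prod1 x (λ k → f k ((x ∸ k) + 1)) ∎

!≡prod1-id : ∀ x → x ! ≡ prod1 x (λ k → k)
!≡prod1-id zero    = refl
!≡prod1-id (suc x) = trans (*-comm (suc x) (x !)) (cong (_* suc x) (!≡prod1-id x))

P-suc-zero : ∀ n → P (suc n) 0 ≡ 0
P-suc-zero n = k>n⇒nCk≡0 (≤-refl {suc n})

P-pascal : ∀ n m → P (suc n) (suc m) ≡ P (suc n) m + P n (suc m)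
P-pascal n m = begin
  (suc m + suc n ∸ 1) C suc n    ≡⟨ cong (_C suc n) (+-suc m n) ⟩
  suc (m + n) C suc n            ≡⟨ nCk+nC[k+1]≡[n+1]C[k+1] (m + n) n ⟨
  (m + n) C n + (m + n) C suc n  ≡⟨ +-comm ((m + n) C n) _ ⟩
  (m + n) C suc n + (m + n) C n  ≡⟨ cong (λ j → (j ∸ 1) C suc n + (m + n) C n) (+-suc m n) ⟨
  P (suc n) m + P n (suc m)      ∎

sf-expansion : ∀ n x → sf n x ≡ prod1 x (λ k → k ^ P n ((x ∸ k) + 1))
sf-expansion zero    x       = trans (!≡prod1-id x) (prod1-cong x (λ {k} _ → sym (*-identityʳ k)))
sf-expansion (suc n) zero    = refl
sf-expansion (suc n) (suc x) = begin
  sf (suc n) x * sf n (suc x)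
    ≡⟨ cong₂ _*_ (sf-expansion (suc n) x) (sf-expansion n (suc x)) ⟩
  prod1 x (λ k → k ^ P (suc n) ((x ∸ k) + 1)) * prod1 (suc x) B
    ≡⟨ cong (_* prod1 (suc x) B) (prod1-cong x (λ {k} k≤x → cong (λ j → k ^ P (suc n) j) (∸+1≡suc∸ k≤x))) ⟩
  prod1 x A * prod1 (suc x) B
    ≡⟨ cong (_* prod1 (suc x) B) (prod1-extend x A[1+x]≡1) ⟨
  prod1 (suc x) A * prod1 (suc x) B
    ≡⟨ prod1-* (suc x) A B ⟨
  prod1 (suc x) (λ k → A k * B k)
    ≡⟨ prod1-cong (suc x) (λ {k} _ → pascal-merge k) ⟩
  prod1 (suc x) (λ k → k ^ P (suc n) ((suc x ∸ k) + 1)) ∎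
  where
  A B : ℕ → ℕ
  A k = k ^ P (suc n) (suc x ∸ k)
  B k = k ^ P n ((suc x ∸ k) + 1)

  A[1+x]≡1 : A (suc x) ≡ 1
  A[1+x]≡1 = trans (cong (λ j → suc x ^ P (suc n) j) (n∸n≡0 x)) (cong (suc x ^_) (P-suc-zero n))

  pascal-merge : ∀ k → A k * B k ≡ k ^ P (suc n) ((suc x ∸ k) + 1)
  pascal-merge k = let m = suc x ∸ k in begin
    k ^ P (suc n) m * k ^ P n (m + 1)  ≡⟨ ^-distribˡ-+-* k (P (suc n) m) _ ⟨
    k ^ (P (suc n) m + P n (m + 1))    ≡⟨ cong (λ j → k ^ (P (suc n) m + P n j)) (+-comm m 1) ⟩
    k ^ (P (suc n) m + P n (suc m))    ≡⟨ cong (k ^_) (P-pascal n m) ⟨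
    k ^ P (suc n) (suc m)              ≡⟨ cong (λ j → k ^ P (suc n) j) (+-comm 1 m) ⟩
    k ^ P (suc n) (m + 1)              ∎

theorem3p2 : (x n : ℕ) → 1 ≤ x →
    (sf n x ≡ prod1 x (λ k → ((x ∸ k) + 1) ^ P n k))
    × (prod1 x (λ k → ((x ∸ k) + 1) ^ P n k) ≡ prod1 x (λ k → k ^ P n ((x ∸ k) + 1)))
theorem3p2 x n _ = trans (sf-expansion n x) (sym reflected) , reflected
  where
  reflected : prod1 x (λ k → ((x ∸ k) + 1) ^ P n k) ≡ prod1 x (λ k → k ^ P n ((x ∸ k) + 1))
  reflected = prod1-reflect x (λ a b → a ^ P n b)
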